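{- Let $S$ be a regular closed semi-Thue system over $\Sigma$, let $\mathcal A$ be a finite state automaton representing the languages $L_a(S)$, and let $F$ be a formula. If (an execution of) $Prove_1(\mathcal A,\{F\})$ returns $\top$ then $F$ is provable in $\mathrm{DKm}(\mathcal A)$. If $Prove_1(\mathcal A,\{F\})$ returns $\bot$ then $F$ is not provable in $\mathrm{DKm}(\mathcal A)$.
   Context: $\Sigma$: alphabet with involution $a\mapsto\bar a$; $\overline{a_1\cdots a_n}=\bar a_n\cdots\bar a_1$. Semi-Thue system $S$: rules $u\to v$; closed if $u\to v\in S\Rightarrow\bar u\to\bar v\in S$; $L_a(S)=\{u\mid a\Rightarrow_S u\}$; regular: all rules of form $a\to u$ and each $L_a(S)$ regular. $\mathcal A=(\Sigma,Q,I,F_{\mathcal A},\delta)$ is an FSA without silent transitions, each $a$ has a unique initial state $init_a\in I$, and $\mathcal A$ with sole initial state $init_a$ accepts $L_a(S)$; $s\xrightarrow{a}_{\mathcal A}s'$ means $(s,a,s')\in\delta$. Formulae are in negation normal form; $\sim\! A$ is the nnf of $\neg A$. A nested sequent is a finite multiset of formulae, labelled formulae $s:A$ ($s\in Q$) and structures $a\{\Delta\}$, viewed as a tree: nodes carry multisets ($\Gamma|i$ denotes the multiset at node $i$), edges are $\Sigma$-labelled, $i\xrightarrow{a}j$ means $j$ is an $a$-child of $i$; $\Gamma(i\ll\Delta)$ adds $\Delta$ to node $i$. $\mathrm{DKm}(\mathcal A)$ rules (conclusion from premises): $\mathit{id}_d$: $\Gamma[p,\neg p]$; $\land_d$: $\Gamma[A\land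 B]$ from $\Gamma[A\land B,A]$, $\Gamma[A\land B,B]$; $\lor_d$: $\Gamma[A\lor B]$ from $\Gamma[A\lor B,A,B]$; $[a]_d$: $\Gamma[[a]A]$ from $\Gamma[[a]A,a\{A\}]$; $\langle a\rangle\!\uparrow$: $\Gamma[a\{\Delta\},\langle a\rangle A]$ from $\Gamma[a\{\Delta,A\},\langle a\rangle A]$; $\langle a\rangle\!\downarrow$: $\Gamma[a\{\Delta,\langle\bar a\rangle A\}]$ from $\Gamma[a\{\Delta,\langle\bar a\rangle A\},A]$; $i$: $\Gamma[\langle a\rangle A]$ from $\Gamma[\langle a\rangle A,init_a:A]$; $t\!\uparrow$: $\Gamma[s:A,a\{\Delta\}]$ from $\Gamma[s:A,a\{s':A,\Delta\}]$ if $s\xrightarrow{a}_{\mathcal A}s'$; $t\!\downarrow$: $\Gamma[a\{s:A,\Delta\}]$ from $\Gamma[a\{s:A,\Delta\},s':A]$ if $s\xrightarrow{\bar a}_{\mathcal A}s'$; $f$: $\Gamma[s:A]$ from $\Gamma[s:A,A]$ if $s\in F_{\mathcal A}$. Node $i$ is saturated if: $A\in\Gamma|i$ implies $\sim\! A\notin\Gamma|i$; $A\lor B\in\Gamma|i$ implies $A,B\in\Gamma|i$; $A\land B\in\Gamma|i$ implies $A\in\Gamma|i$ or $B\in\Gamma|i$. Node $i$ is realised if $[a]A\in\Gamma|i$ implies $A\in\Gamma|j$ for some $j$ with $i\xrightarrow{a}j$. $\Gamma$ is $\mathcal A$-propagated if for every node $i$: (1) $\langle a\rangle A\in\Gamma|i\Rightarrow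 init_a:A\in\Gamma|i$; (2) $s:A\in\Gamma|i$, $s\in F_{\mathcal A}\Rightarrow A\in\Gamma|i$; (3) $i\xrightarrow{a}j$, $s\xrightarrow{a}_{\mathcal A}t$, $s:A\in\Gamma|i\Rightarrow t:A\in\Gamma|j$; (4) $j\xrightarrow{a}i$, $s\xrightarrow{\bar a}_{\mathcal A}t$, $s:A\in\Gamma|i\Rightarrow t:A\in\Gamma|j$. A leaf $i$ is a loop node if some ancestor $j$ has $\Gamma|j=\Gamma|i$. $\Gamma$ is $\mathcal A$-stable if every node is saturated, $\Gamma$ is $\mathcal A$-propagated, every internal node is realised, and every leaf is a loop node or realised. $Prove_1(\mathcal A,\Gamma)$ (with nondeterministic choices): (1) if some node contains $p$ and $\neg p$, return $\top$; (2) if $\Gamma$ is $\mathcal A$-stable return $\bot$; (3) if $\Gamma$ is not saturated: (a) if $A\lor B\in\Gamma|i$ but $A\notin\Gamma|i$ or $B\notin\Gamma|i$, return $Prove_1(\mathcal A,\Gamma(i\ll\{A,B\}))$; (b) if $A_1\land A_2\in\Gamma|i$ with neither $A_1$ nor $A_2$ in $\Gamma|i$, return $\bot$ if $Prove_1(\mathcal A,\Gamma(i\ll\{A_k\}))=\bot$ for some $k\in\{1,2\}$, else $\top$; (4) if $\Gamma$ is not $\mathcal A$-propagated, add to the appropriate node the missing formula for one violated instance of (1)–(4) above and recurse; (5) if some internal node $i$ is not realised, with $[a]A\in\Gamma|i$ and $A\notin\Gamma|j$ for all $a$-children $j$, return $Prove_1(\mathcal A,\Gamma(i\ll a\{A\}))$;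 (6) if some leaf $i$ is not realised and not a loop node, with $[a]A\in\Gamma|i$, return $Prove_1(\mathcal A,\Gamma(i\ll a\{A\}))$. -}

module Defs where

open import Data.Nat using (ℕ; zero; suc)
open import Data.Fin using (Fin)
open import Data.Bool using (Bool; true; false; T)
open import Data.List using (List; []; _∷_; _++_; map; reverse)
open import Data.List.Membership.Propositional using (_∈_)
open import Data.List.Relation.Binary.Permutation.Propositional using (_↭_)
open import Data.Maybe using (Maybe; just; nothing)
open import Data.Product using (Σ; ∃; ∃-syntax; _×_; _,_; proj₁; proj₂)
open import Data.Sum using (_⊎_)
open import Relation.Nullary using (¬_)
open import Relation.Binary.PropositionalEquality using (_≡_; _≢_)
open import Relation.Binary.Construct.Closure.ReflexiveTransitive using (Star)
open import Function.Bundles using (_⇔_)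

record Alphabet : Set where
  field
    size   : ℕ
    bar    : Fin size → Fin size
    bar-invol : ∀ a → bar (bar a) ≡ a

open Alphabet public

Sym : Alphabet → Set
Sym Σ' = Fin (size Σ')

Word : Alphabet → Set
Word Σ' = List (Sym Σ')

barW : (Σ' : Alphabet) → Word Σ' → Word Σ'
barW Σ' w = reverse (map (bar Σ') w)

data Acc {n m : ℕ} (δ : Fin m → Fin n → Fin m → Bool) (final : Fin m → Bool)
         : Fin m → List (Fin n) → Set where
  acc-nil  : ∀ {s} → T (final s) → Acc δ final s []
  acc-cons : ∀ {s a t w} → T (δ s a t) → Acc δ final t w → Acc δ final s (a ∷ w)

Regular : (Σ' : Alphabet) → (Word Σ' → Set) → Set
Regular Σ' L =
  Σ ℕ λ m → Σ (Fin m → Sym Σ' → Fin m → Bool) λ δ → Σ (Fin m → Bool) λ final →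
  Σ (Fin m) λ s₀ → ∀ w → L w ⇔ Acc δ final s₀ w

-- The automaton 𝒜 = (Σ, Q, I, F_𝒜, δ) with Q = Fin states and a designated
-- initial state init a ∈ I for every letter a.
record FSA (Σ' : Alphabet) : Set where
  field
    states  : ℕ
    δ       : Fin states → Sym Σ' → Fin states → Bool
    initial : Fin states → Bool
    final   : Fin states → Bool
    init    : Sym Σ' → Fin states
    init∈I  : ∀ a → T (initial (init a))

open FSA public

_⊢_—[_]→_ : {Σ' : Alphabet} (𝒜 : FSA Σ') → Fin (states 𝒜) → Sym Σ' → Fin (states 𝒜) → Set
𝒜 ⊢ s —[ a ]→ t = T (δ 𝒜 s a t)

STS : Alphabet → Set
STS Σ' = List (Word Σ' × Word Σ')

data Step (Σ' : Alphabet) (S : STS Σ') : Word Σ' → Word Σ' → Set where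
  step : ∀ {u v} (x y : Word Σ') → (u , v) ∈ S → Step Σ' S (x ++ u ++ y) (x ++ v ++ y)

Lang : (Σ' : Alphabet) → STS Σ' → Sym Σ' → Word Σ' → Set
Lang Σ' S a u = Star (Step Σ' S) (a ∷ []) u

Closed : (Σ' : Alphabet) → STS Σ' → Set
Closed Σ' S = ∀ {u v} → (u , v) ∈ S → (barW Σ' u , barW Σ' v) ∈ S

RegularSTS : (Σ' : Alphabet) → STS Σ' → Set
RegularSTS Σ' S =
  (∀ {u v} → (u , v) ∈ S → ∃[ a ] (u ≡ a ∷ [])) × (∀ a → Regular Σ' (Lang Σ' S a))

Represents : (Σ' : Alphabet) → STS Σ' → FSA Σ' → Set
Represents Σ' S 𝒜 = ∀ a w → Lang Σ' S a w ⇔ Acc (δ 𝒜) (final 𝒜) (init 𝒜 a) w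

-- Formulae in negation normal form (atoms indexed by ℕ)

data Fm (n : ℕ) : Set where
  var  : ℕ → Fm n
  nvar : ℕ → Fm n
  _∧_  : Fm n → Fm n → Fm n
  _∨_  : Fm n → Fm n → Fm n
  box  : Fin n → Fm n → Fm n
  dia  : Fin n → Fm n → Fm n

∼_ : ∀ {n} → Fm n → Fm n
∼ var p   = nvar p
∼ nvar p  = var p
∼ (A ∧ B) = (∼ A) ∨ (∼ B)
∼ (A ∨ B) = (∼ A) ∧ (∼ B)
∼ box a A = dia a (∼ A)
∼ dia a A = box a (∼ A)

-- Nested sequents (trees).  A node carries a list (read as multiset) of
-- formulae and labelled formulae s:A, and a list of Σ-labelled children.

data Item (n m : ℕ) : Set where
  fm  : Fm n → Item n m
  lab : Fin m → Fm n → Item n m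

data Seq (n m : ℕ) : Set where
  node : List (Item n m) → List (Fin n × Seq n m) → Seq n m

module _ {n m : ℕ} where

  items : Seq n m → List (Item n m)
  items (node Γ cs) = Γ

  kids : Seq n m → List (Fin n × Seq n m)
  kids (node Γ cs) = cs

  lookupL : {X : Set} → List X → ℕ → Maybe X
  lookupL []       k       = nothing
  lookupL (x ∷ xs) zero    = just x
  lookupL (x ∷ xs) (suc k) = lookupL xs k

  updateL : {X : Set} → ℕ → (X → X) → List X → List X
  updateL k       f []       = []
  updateL zero    f (x ∷ xs) = f x ∷ xs
  updateL (suc k) f (x ∷ xs) = x ∷ updateL k f xs

  -- Nodes are addressed by paths (lists of child indices) from the root.
  Path : Set
  Path = List ℕ

  at : Seq n m → Path → Maybe (Seq n m)
  at s []            = just s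
  at (node Γ cs) (k ∷ p) with lookupL cs k
  ... | nothing      = nothing
  ... | just (a , t) = at t p

  modify : Path → (Seq n m → Seq n m) → Seq n m → Seq n m
  modify []      f s           = f s
  modify (k ∷ p) f (node Γ cs) = node Γ (updateL k (λ { (a , t) → (a , modify p f t) }) cs)

  _∈[_]_ : Item n m → Seq n m → Path → Set
  x ∈[ Γ ] i = ∃[ t ] (at Γ i ≡ just t × x ∈ items t)

  Edge : Seq n m → Path → Fin n → Path → Set
  Edge Γ i a j = ∃[ t ] ∃[ k ] ∃[ u ]
    (at Γ i ≡ just t × lookupL (kids t) k ≡ just (a , u) × j ≡ i ++ (k ∷ []))

  addAt : Path → List (Item n m) → Seq n m → Seq n m
  addAt i Δ = modify i (λ { (node Γ cs) → node (Δ ++ Γ) cs })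

  addChild : Path → Fin n → Fm n → Seq n m → Seq n m
  addChild i a A = modify i (λ { (node Γ cs) → node Γ (cs ++ ((a , node (fm A ∷ []) []) ∷ [])) })

  Leaf : Seq n m → Path → Set
  Leaf Γ i = ∃[ t ] (at Γ i ≡ just t × kids t ≡ [])

  Internal : Seq n m → Path → Set
  Internal Γ i = ∃[ t ] (at Γ i ≡ just t × kids t ≢ [])

  LoopNode : Seq n m → Path → Set
  LoopNode Γ i = Leaf Γ i × ∃[ j ] ∃[ k ] ∃[ p ] ∃[ tj ] ∃[ ti ]
    (i ≡ j ++ (k ∷ p) × at Γ j ≡ just tj × at Γ i ≡ just ti × items tj ↭ items ti)

  SaturatedNode : Seq n m → Path → Set
  SaturatedNode Γ i =
    (∀ A → fm A ∈[ Γ ] i → ¬ (fm (∼ A) ∈[ Γ ] i)) ×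
    (∀ A B → fm (A ∨ B) ∈[ Γ ] i → fm A ∈[ Γ ] i × fm B ∈[ Γ ] i) ×
    (∀ A B → fm (A ∧ B) ∈[ Γ ] i → fm A ∈[ Γ ] i ⊎ fm B ∈[ Γ ] i)

  Saturated : Seq n m → Set
  Saturated Γ = ∀ i → SaturatedNode Γ i

  Realised : Seq n m → Path → Set
  Realised Γ i = ∀ a A → fm (box a A) ∈[ Γ ] i → ∃[ j ] (Edge Γ i a j × fm A ∈[ Γ ] j)

  Clash : Seq n m → Set
  Clash Γ = ∃[ i ] ∃[ p ] (fm (var p) ∈[ Γ ] i × fm (nvar p) ∈[ Γ ] i)

root : ∀ {n m} → Fm n → Seq n m
root F = node (fm F ∷ []) []

module _ {Σ' : Alphabet} (𝒜 : FSA Σ') where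

  private
    n = size Σ'
    m = states 𝒜

  SeqA : Set
  SeqA = Seq n m

  Propagated : SeqA → Set
  Propagated Γ = ∀ i →
    (∀ a A → fm (dia a A) ∈[ Γ ] i → lab (init 𝒜 a) A ∈[ Γ ] i) ×
    (∀ s A → lab s A ∈[ Γ ] i → T (final 𝒜 s) → fm A ∈[ Γ ] i) ×
    (∀ a j s t A → Edge Γ i a j → 𝒜 ⊢ s —[ a ]→ t → lab s A ∈[ Γ ] i → lab t A ∈[ Γ ] j) ×
    (∀ a j s t A → Edge Γ j a i → 𝒜 ⊢ s —[ bar Σ' a ]→ t → lab s A ∈[ Γ ] i → lab t A ∈[ Γ ] j)

  Stable : SeqA → Set
  Stable Γ = Saturated Γ × Propagated Γ ×
             (∀ i → Internal Γ i → Realised Γ i) ×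
             (∀ i → Leaf Γ i → LoopNode Γ i ⊎ Realised Γ i)

  data DKm : SeqA → Set where
    id-d  : ∀ {Γ i p} → fm (var p) ∈[ Γ ] i → fm (nvar p) ∈[ Γ ] i → DKm Γ
    ∧-d   : ∀ {Γ i A B} → fm (A ∧ B) ∈[ Γ ] i →
            DKm (addAt i (fm A ∷ []) Γ) → DKm (addAt i (fm B ∷ []) Γ) → DKm Γ
    ∨-d   : ∀ {Γ i A B} → fm (A ∨ B) ∈[ Γ ] i →
            DKm (addAt i (fm A ∷ fm B ∷ []) Γ) → DKm Γ
    box-d : ∀ {Γ i a A} → fm (box a A) ∈[ Γ ] i → DKm (addChild i a A Γ) → DKm Γ
    dia↑  : ∀ {Γ i j a A} → fm (dia a A) ∈[ Γ ] i → Edge Γ i a j →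
            DKm (addAt j (fm A ∷ []) Γ) → DKm Γ
    dia↓  : ∀ {Γ i j a A} → Edge Γ i a j → fm (dia (bar Σ' a) A) ∈[ Γ ] j →
            DKm (addAt i (fm A ∷ []) Γ) → DKm Γ
    i-r   : ∀ {Γ i a A} → fm (dia a A) ∈[ Γ ] i →
            DKm (addAt i (lab (init 𝒜 a) A ∷ []) Γ) → DKm Γ
    t↑    : ∀ {Γ i j a s s' A} → lab s A ∈[ Γ ] i → Edge Γ i a j → 𝒜 ⊢ s —[ a ]→ s' →
            DKm (addAt j (lab s' A ∷ []) Γ) → DKm Γ
    t↓    : ∀ {Γ i j a s s' A} → Edge Γ i a j → lab s A ∈[ Γ ] j → 𝒜 ⊢ s —[ bar Σ' a ]→ s' →
            DKm (addAt i (lab s' A ∷ []) Γ) → DKm Γ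
    f-r   : ∀ {Γ i s A} → lab s A ∈[ Γ ] i → T (final 𝒜 s) →
            DKm (addAt i (fm A ∷ []) Γ) → DKm Γ

  Step3a : SeqA → Set
  Step3a Γ = ∃[ i ] ∃[ A ] ∃[ B ]
    (fm (A ∨ B) ∈[ Γ ] i × (¬ fm A ∈[ Γ ] i ⊎ ¬ fm B ∈[ Γ ] i))

  Step3b : SeqA → Set
  Step3b Γ = ∃[ i ] ∃[ A ] ∃[ B ]
    (fm (A ∧ B) ∈[ Γ ] i × ¬ fm A ∈[ Γ ] i × ¬ fm B ∈[ Γ ] i)

  Past3 : SeqA → Set
  Past3 Γ = ¬ Clash Γ × ¬ Stable Γ × ¬ Step3a Γ × ¬ Step3b Γ

  -- Prove₁(𝒜, Γ) has an execution returning r   (true = ⊤, false = ⊥)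
  data Prove₁ : SeqA → Bool → Set where
    s1   : ∀ {Γ} → Clash Γ → Prove₁ Γ true
    s2   : ∀ {Γ} → ¬ Clash Γ → Stable Γ → Prove₁ Γ false
    s3a  : ∀ {Γ i A B r} → ¬ Clash Γ → ¬ Stable Γ →
           fm (A ∨ B) ∈[ Γ ] i → (¬ fm A ∈[ Γ ] i ⊎ ¬ fm B ∈[ Γ ] i) →
           Prove₁ (addAt i (fm A ∷ fm B ∷ []) Γ) r → Prove₁ Γ r
    s3b₁⊥ : ∀ {Γ i A B} → ¬ Clash Γ → ¬ Stable Γ →
           fm (A ∧ B) ∈[ Γ ] i → ¬ fm A ∈[ Γ ] i → ¬ fm B ∈[ Γ ] i →
           Prove₁ (addAt i (fm A ∷ []) Γ) false → Prove₁ Γ false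
    s3b₂⊥ : ∀ {Γ i A B} → ¬ Clash Γ → ¬ Stable Γ →
           fm (A ∧ B) ∈[ Γ ] i → ¬ fm A ∈[ Γ ] i → ¬ fm B ∈[ Γ ] i →
           Prove₁ (addAt i (fm B ∷ []) Γ) false → Prove₁ Γ false
    s3b⊤ : ∀ {Γ i A B} → ¬ Clash Γ → ¬ Stable Γ →
           fm (A ∧ B) ∈[ Γ ] i → ¬ fm A ∈[ Γ ] i → ¬ fm B ∈[ Γ ] i →
           Prove₁ (addAt i (fm A ∷ []) Γ) true → Prove₁ (addAt i (fm B ∷ []) Γ) true →
           Prove₁ Γ true
    s4-1 : ∀ {Γ i a A r} → Past3 Γ →
           fm (dia a A) ∈[ Γ ] i → ¬ lab (init 𝒜 a) A ∈[ Γ ] i →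
           Prove₁ (addAt i (lab (init 𝒜 a) A ∷ []) Γ) r → Prove₁ Γ r
    s4-2 : ∀ {Γ i s A r} → Past3 Γ →
           lab s A ∈[ Γ ] i → T (final 𝒜 s) → ¬ fm A ∈[ Γ ] i →
           Prove₁ (addAt i (fm A ∷ []) Γ) r → Prove₁ Γ r
    s4-3 : ∀ {Γ i j a s t A r} → Past3 Γ →
           Edge Γ i a j → 𝒜 ⊢ s —[ a ]→ t → lab s A ∈[ Γ ] i → ¬ lab t A ∈[ Γ ] j →
           Prove₁ (addAt j (lab t A ∷ []) Γ) r → Prove₁ Γ r
    s4-4 : ∀ {Γ i j a s t A r} → Past3 Γ →
           Edge Γ j a i → 𝒜 ⊢ s —[ bar Σ' a ]→ t → lab s A ∈[ Γ ] i → ¬ lab t A ∈[ Γ ] j →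
           Prove₁ (addAt j (lab t A ∷ []) Γ) r → Prove₁ Γ r
    s5   : ∀ {Γ i a A r} → Past3 Γ → Propagated Γ →
           Internal Γ i → fm (box a A) ∈[ Γ ] i → (∀ j → Edge Γ i a j → ¬ fm A ∈[ Γ ] j) →
           Prove₁ (addChild i a A Γ) r → Prove₁ Γ r
    s6   : ∀ {Γ i a A r} → Past3 Γ → Propagated Γ → (∀ k → Internal Γ k → Realised Γ k) →
           Leaf Γ i → ¬ Realised Γ i → ¬ LoopNode Γ i → fm (box a A) ∈[ Γ ] i →
           Prove₁ (addChild i a A Γ) r → Prove₁ Γ r

-- Every step of Prove₁ that returns ⊤ is an instance of a DKm(𝒜) rule read upwards, so a
-- ⊤-execution is a derivation.  A ⊥-execution only ever enlarges the sequent and stops at an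
-- 𝒜-stable Γ*, into which the input therefore embeds.  A stable sequent is a countermodel:
-- by induction on derivations, no sequent embedding into Γ* is derivable, since each rule's
-- premise still embeds into Γ* once the added formula (or child) is located there.  Saturation
-- handles ∧ and ∨, the propagation clauses handle the structural rules, and [a]A is realised
-- at an internal node or, at a loop leaf, by its ancestor with the same formulae.  The ⟨a⟩
-- rules need a single fact about 𝒜: a is accepted from init_a, because a ∈ L_a(S).
module Submission where

open import Defs
open import Data.Nat using (ℕ; zero; suc)
open import Data.Fin using (Fin)
open import Data.Product using (Σ; ∃-syntax; _×_; _,_; proj₁; proj₂)
open import Data.List using (List; []; _∷_; _++_)
open import Data.List.Properties using (++-identityʳ)
open import Data.List.Relation.Unary.All as All using (All; []; _∷_)
open import Data.List.Relation.Unary.All.Properties using (++⁺; ++⁻ˡ; ++⁻ʳ)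
open import Data.Maybe using (Maybe; just)
open import Data.Maybe.Properties using (just-injective)
open import Data.Bool using (true; false; T)
open import Data.Sum using (_⊎_; inj₁; inj₂)
open import Data.List.Relation.Binary.Permutation.Propositional using (_↭_; ↭-sym)
open import Data.List.Relation.Binary.Permutation.Propositional.Properties using (∈-resp-↭)
open import Relation.Nullary using (¬_)
open import Relation.Binary.Construct.Closure.ReflexiveTransitive using (ε)
open import Function.Bundles using (Equivalence)
open import Relation.Binary.PropositionalEquality using (_≡_; _≢_; refl; sym; trans; cong; subst; subst₂)

module _ {n m : ℕ} where

  -- lookupL with its implicit arguments, which cannot be inferred from its type, fixed
  lookupKid : List (Fin n × Seq n m) → ℕ → Maybe (Fin n × Seq n m)
  lookupKid = lookupL {n} {m}

  at-∷⁻ : ∀ {Δ : List (Item n m)} {t} cs k p → at (node Δ cs) (k ∷ p) ≡ just t →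
          ∃[ a ] ∃[ u ] (lookupKid cs k ≡ just (a , u) × at u p ≡ just t)
  at-∷⁻ cs k p e with lookupKid cs k
  ... | just (a , u) = a , u , refl , e

  at-kid : ∀ Δ cs {k a u} → lookupKid cs k ≡ just (a , u) → at (node Δ cs) (k ∷ []) ≡ just u
  at-kid _ _ l rewrite l = refl

  at-++⁺ : ∀ (s : Seq n m) i {q t u} → at s i ≡ just t → at t q ≡ just u → at s (i ++ q) ≡ just u
  at-++⁺ s [] refl h = h
  at-++⁺ (node Δ cs) (k ∷ i) e h with lookupKid cs k
  ... | just (a , t) = at-++⁺ t i e h

  at-++⁻ : ∀ (s : Seq n m) i {q t u} → at s (i ++ q) ≡ just u → at s i ≡ just t → at t q ≡ just u
  at-++⁻ s [] h refl = h
  at-++⁻ (node Δ cs) (k ∷ i) h e with lookupKid cs k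
  ... | just (a , t) = at-++⁻ t i h e

  at-∷⇒internal : ∀ (t : Seq n m) {u k p} → at t (k ∷ p) ≡ just u → kids t ≢ []
  at-∷⇒internal (node _ []) ()
  at-∷⇒internal (node _ (_ ∷ _)) _ ()

module Embedding {n m : ℕ} (Γ* : Seq n m) where

  SameItems : List ℕ → List ℕ → Set
  SameItems x x' = (∀ {it} → it ∈[ Γ* ] x → it ∈[ Γ* ] x') × (∀ {it} → it ∈[ Γ* ] x' → it ∈[ Γ* ] x)

  sameItems-↭ : ∀ x x' {t t'} → at Γ* x ≡ just t → at Γ* x' ≡ just t' → items t ↭ items t' → SameItems x x'
  sameItems-↭ x x' hx hx' t↭t' = move {x} {x'} hx hx' t↭t' , move {x'} {x} hx' hx (↭-sym t↭t')
    where
    move : ∀ {x x' t t' it} → at Γ* x ≡ just t → at Γ* x' ≡ just t' → items t ↭ items t' →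
           it ∈[ Γ* ] x → it ∈[ Γ* ] x'
    move hx hx' t↭t' (_ , h , it∈) with just-injective (trans (sym hx) h)
    ... | refl = _ , hx' , ∈-resp-↭ t↭t' it∈

  -- An a-child of a node imaged at x is sent to the end y of an a-edge whose source merely has
  -- the same items as x; this slack is what lets loop leaves borrow their ancestor's children.
  record Link (a : Fin n) (x y : List ℕ) : Set where
    constructor link
    field
      {source}  : List ℕ
      edge      : Edge Γ* source a y
      sameItems : SameItems x source

  edge⇒Link : ∀ {x a y} → Edge Γ* x a y → Link a x y
  edge⇒Link ed = link ed ((λ z → z) , (λ z → z))

  data Emb (x : List ℕ) : Seq n m → Set
  data KidEmb (x : List ℕ) : Fin n × Seq n m → Set

  data Emb x where
    emb : ∀ {Δ cs} → All (λ it → it ∈[ Γ* ] x) Δ → All (KidEmb x) cs → Emb x (node Δ cs)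

  data KidEmb x where
    kid : ∀ {a u} y → Link a x y → Emb y u → KidEmb x (a , u)

  EmbKids : List ℕ → List (Fin n × Seq n m) → Set
  EmbKids x = All (KidEmb x)

  mutual
    image : ∀ {x s} → Emb x s → List ℕ → List ℕ
    image {x} _          []      = x
    image     (emb _ ks) (k ∷ p) = imageKids ks k p

    imageKids : ∀ {x cs} → EmbKids x cs → ℕ → List ℕ → List ℕ
    imageKids {x} []           _       _ = x
    imageKids (_ ∷ ks)         (suc k) p = imageKids ks k p
    imageKids (kid _ _ e ∷ _)  zero    p = image e p

  EmbKids-lookup : ∀ {x cs k a u} (ks : EmbKids x cs) → lookupKid cs k ≡ just (a , u) →
                   ∃[ y ] (Link a x y × Σ (Emb y u) λ e → ∀ q → imageKids ks k q ≡ image e q)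
  EmbKids-lookup {k = zero}  (kid y l e ∷ _) refl = y , l , e , λ _ → refl
  EmbKids-lookup {k = suc k} (_ ∷ ks)        l    = EmbKids-lookup ks l

  Emb-at : ∀ {x s t} (e : Emb x s) i → at s i ≡ just t →
           ∃[ y ] Σ (Emb y t) λ e' → ∀ q → image e (i ++ q) ≡ image e' q
  Emb-at e [] refl = _ , e , λ _ → refl
  Emb-at {s = node Δ cs} (emb _ ks) (k ∷ p) h with at-∷⁻ {Δ = Δ} cs k p h
  ... | _ , _ , l , h' with EmbKids-lookup ks l
  ... | _ , _ , eₖ , eqₖ with Emb-at eₖ p h'
  ... | y , e' , eq = y , e' , λ q → trans (eqₖ (p ++ q)) (eq q)

  image-root : ∀ {x s y t} (e : Emb x s) i {e' : Emb y t} →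
               (∀ q → image e (i ++ q) ≡ image e' q) → image e i ≡ y
  image-root e i eq = trans (cong (image e) (sym (++-identityʳ i))) (eq [])

  image-∈ : ∀ {x s it} (e : Emb x s) i → it ∈[ s ] i → it ∈[ Γ* ] image e i
  image-∈ {it = it} e i (t , h , it∈t) with Emb-at e i h
  ... | y , emb its _ , eq =
    subst (it ∈[ Γ* ]_) (sym (image-root e i eq)) (All.lookup its it∈t)

  image-Link : ∀ {x s a} (e : Emb x s) i j → Edge s i a j → Link a (image e i) (image e j)
  image-Link {a = a} e i _ (t , k , u , h , l , refl) with Emb-at e i h
  ... | y , emb _ ks , eq with EmbKids-lookup ks l
  ... | _ , l′ , _ , eqₖ =
    subst₂ (Link a) (sym (image-root e i eq)) (sym (trans (eq (k ∷ [])) (eqₖ []))) l′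

  mutual
    grow : (g : Seq n m → Seq n m) → ∀ {x s} (e : Emb x s) i →
           (∀ {t} → Emb (image e i) t → Emb (image e i) (g t)) → Emb x (modify i g s)
    grow g e            []      h = h e
    grow g (emb its ks) (k ∷ p) h = emb its (growKids g ks k p h)

    growKids : (g : Seq n m → Seq n m) → ∀ {x cs} (ks : EmbKids x cs) k p →
               (∀ {t} → Emb (imageKids ks k p) t → Emb (imageKids ks k p) (g t)) →
               EmbKids x (kids (modify (k ∷ p) g (node [] cs)))
    growKids g []               _       _ _ = []
    growKids g (kid y l e ∷ ks) zero    p h = kid y l (grow g e p h) ∷ ks
    growKids g (κ ∷ ks)         (suc k) p h = κ ∷ growKids g ks k p h

  module _ (g : Seq n m → Seq n m) (shrink-root : ∀ {y t} → Emb y (g t) → Emb y t) where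
    mutual
      shrink : ∀ {x s} i → Emb x (modify i g s) → Emb x s
      shrink                 []      e            = shrink-root e
      shrink {s = node _ cs} (k ∷ p) (emb its ks) = emb its (shrinkKids cs k p ks)

      shrinkKids : ∀ {x} cs k p → EmbKids x (kids (modify (k ∷ p) g (node [] cs))) → EmbKids x cs
      shrinkKids []       _       _ []               = []
      shrinkKids (_ ∷ _)  zero    p (kid y l e ∷ ks) = kid y l (shrink p e) ∷ ks
      shrinkKids (_ ∷ cs) (suc k) p (κ ∷ ks)         = κ ∷ shrinkKids cs k p ks

  grow-addAt : ∀ {x s Δ} (e : Emb x s) i → All (λ it → it ∈[ Γ* ] image e i) Δ → Emb x (addAt i Δ s)
  grow-addAt {Δ = Δ} e i hΔ = grow (addAt [] Δ) e i λ { (emb its ks) → emb (++⁺ hΔ its) ks }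

  grow-addChild : ∀ {x s a A y} (e : Emb x s) i → Link a (image e i) y → fm A ∈[ Γ* ] y →
                  Emb x (addChild i a A s)
  grow-addChild {a = a} {A} {y} e i l hA =
    grow (addChild [] a A) e i λ { (emb its ks) → emb its (++⁺ ks (kid y l (emb (hA ∷ []) []) ∷ [])) }

  shrink-addAt : ∀ {x s Δ} i → Emb x (addAt i Δ s) → Emb x s
  shrink-addAt {Δ = Δ} = shrink (addAt [] Δ) λ {_} {t} → drop t
    where
    drop : ∀ {y} t → Emb y (addAt [] Δ t) → Emb y t
    drop (node _ _) (emb its ks) = emb (++⁻ʳ Δ its) ks

  shrink-addChild : ∀ {x s a A} i → Emb x (addChild i a A s) → Emb x s
  shrink-addChild {a = a} {A} = shrink (addChild [] a A) λ {_} {t} → drop t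
    where
    drop : ∀ {y} t → Emb y (addChild [] a A t) → Emb y t
    drop (node _ cs) (emb its ks) = emb its (++⁻ˡ cs ks)

  mutual
    emb-self : ∀ {x t} → at Γ* x ≡ just t → Emb x t
    emb-self {x} {node Δ cs} h =
      emb (All.tabulate (λ it∈ → _ , h , it∈))
          (embKids-self cs λ l → _ , (_ , _ , _ , h , l , refl) , at-++⁺ Γ* x h (at-kid Δ cs l))

    embKids-self : ∀ {x} cs →
                   (∀ {k a u} → lookupKid cs k ≡ just (a , u) → ∃[ y ] (Edge Γ* x a y × at Γ* y ≡ just u)) →
                   EmbKids x cs
    embKids-self []       _ = []
    embKids-self (_ ∷ cs) h with h {zero} refl
    ... | y , ed , hy = kid y (edge⇒Link ed) (emb-self hy) ∷ embKids-self cs (λ {k} → h {suc k})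

module _ {Σ' : Alphabet} (𝒜 : FSA Σ') where

  prove⊤⇒DKm : ∀ {Γ} → Prove₁ 𝒜 Γ true → DKm 𝒜 Γ
  prove⊤⇒DKm (s1 (i , _ , h₁ , h₂))                   = id-d {i = i} h₁ h₂
  prove⊤⇒DKm (s3a {i = i} _ _ h _ pr)                 = ∨-d {i = i} h (prove⊤⇒DKm pr)
  prove⊤⇒DKm (s3b⊤ {i = i} _ _ h _ _ pr₁ pr₂)         = ∧-d {i = i} h (prove⊤⇒DKm pr₁) (prove⊤⇒DKm pr₂)
  prove⊤⇒DKm (s4-1 {i = i} _ h _ pr)                  = i-r {i = i} h (prove⊤⇒DKm pr)
  prove⊤⇒DKm (s4-2 {i = i} _ h fin _ pr)              = f-r {i = i} h fin (prove⊤⇒DKm pr)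
  prove⊤⇒DKm (s4-3 {i = i} {j} _ ed tr h _ pr)        = t↑ {i = i} {j} h ed tr (prove⊤⇒DKm pr)
  prove⊤⇒DKm (s4-4 {i = i} {j} _ ed tr h _ pr)        = t↓ {i = j} {i} ed h tr (prove⊤⇒DKm pr)
  prove⊤⇒DKm (s5 {i = i} _ _ _ h _ pr)                = box-d {i = i} h (prove⊤⇒DKm pr)
  prove⊤⇒DKm (s6 {i = i} _ _ _ _ _ _ h pr)            = box-d {i = i} h (prove⊤⇒DKm pr)

  EmbedsInStable : SeqA 𝒜 → Set
  EmbedsInStable Γ = ∃[ Γ* ] (Stable 𝒜 Γ* × Embedding.Emb Γ* [] Γ)

  embedsInStable-addAt⁻ : ∀ {Γ Δ} i → EmbedsInStable (addAt i Δ Γ) → EmbedsInStable Γ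
  embedsInStable-addAt⁻ i (Γ* , st , e) = Γ* , st , Embedding.shrink-addAt Γ* i e

  embedsInStable-addChild⁻ : ∀ {Γ a A} i → EmbedsInStable (addChild i a A Γ) → EmbedsInStable Γ
  embedsInStable-addChild⁻ i (Γ* , st , e) = Γ* , st , Embedding.shrink-addChild Γ* i e

  prove⊥⇒embedsInStable : ∀ {Γ} → Prove₁ 𝒜 Γ false → EmbedsInStable Γ
  prove⊥⇒embedsInStable {Γ} (s2 _ st)                     = Γ , st , Embedding.emb-self Γ refl
  prove⊥⇒embedsInStable (s3a {i = i} _ _ _ _ pr)          = embedsInStable-addAt⁻ i (prove⊥⇒embedsInStable pr)
  prove⊥⇒embedsInStable (s3b₁⊥ {i = i} _ _ _ _ _ pr)      = embedsInStable-addAt⁻ i (prove⊥⇒embedsInStable pr)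
  prove⊥⇒embedsInStable (s3b₂⊥ {i = i} _ _ _ _ _ pr)      = embedsInStable-addAt⁻ i (prove⊥⇒embedsInStable pr)
  prove⊥⇒embedsInStable (s4-1 {i = i} _ _ _ pr)           = embedsInStable-addAt⁻ i (prove⊥⇒embedsInStable pr)
  prove⊥⇒embedsInStable (s4-2 {i = i} _ _ _ _ pr)         = embedsInStable-addAt⁻ i (prove⊥⇒embedsInStable pr)
  prove⊥⇒embedsInStable (s4-3 {j = j} _ _ _ _ _ pr)       = embedsInStable-addAt⁻ j (prove⊥⇒embedsInStable pr)
  prove⊥⇒embedsInStable (s4-4 {j = j} _ _ _ _ _ pr)       = embedsInStable-addAt⁻ j (prove⊥⇒embedsInStable pr)
  prove⊥⇒embedsInStable (s5 {i = i} _ _ _ _ _ pr)         = embedsInStable-addChild⁻ i (prove⊥⇒embedsInStable pr)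
  prove⊥⇒embedsInStable (s6 {i = i} _ _ _ _ _ _ _ pr)     = embedsInStable-addChild⁻ i (prove⊥⇒embedsInStable pr)

  LettersAccepted : Set
  LettersAccepted = ∀ a → ∃[ t ] (𝒜 ⊢ init 𝒜 a —[ a ]→ t × T (final 𝒜 t))

  module Countermodel (Γ* : SeqA 𝒜) (stable : Stable 𝒜 Γ*) (accepted : LettersAccepted) where
    open Embedding Γ*

    private
      saturated : Saturated Γ*
      saturated = proj₁ stable

      propagated : Propagated 𝒜 Γ*
      propagated = proj₁ (proj₂ stable)

      internal-realised : ∀ x → Internal Γ* x → Realised Γ* x
      internal-realised = proj₁ (proj₂ (proj₂ stable))

      leaf-realised : ∀ x → Leaf Γ* x → LoopNode Γ* x ⊎ Realised Γ* x
      leaf-realised = proj₂ (proj₂ (proj₂ stable))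

    realise : ∀ {a A} x → fm (box a A) ∈[ Γ* ] x → ∃[ y ] (Link a x y × fm A ∈[ Γ* ] y)
    realise {a} {A} x h@(node _ (_ ∷ _) , hx , _) with internal-realised x (_ , hx , λ ()) a A h
    ... | y , ed , hA = y , (edge⇒Link ed) , hA
    realise {a} {A} x h@(node _ [] , hx , box∈) with leaf-realised x (_ , hx , refl)
    ... | inj₂ realised with realised a A h
    ...   | y , ed , hA = y , (edge⇒Link ed) , hA
    realise {a} {A} _ (node _ [] , hx , box∈) | inj₁ (_ , j , k , p , tj , ti , refl , hj , hi , tj↭ti)
      with just-injective (trans (sym hx) hi)
    ... | refl with internal-realised j (tj , hj , at-∷⇒internal tj (at-++⁻ Γ* j hi hj)) a A
                                     (tj , hj , ∈-resp-↭ (↭-sym tj↭ti) box∈)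
    ...   | y , ed , hA = y , (link ed (sameItems-↭ (j ++ k ∷ p) j hi hj (↭-sym tj↭ti))) , hA

    init-of-dia : ∀ {a A} x → fm (dia a A) ∈[ Γ* ] x → lab (init 𝒜 a) A ∈[ Γ* ] x
    init-of-dia {a} {A} x = proj₁ (propagated x) a A

    fm-of-final : ∀ {s A} x → lab s A ∈[ Γ* ] x → T (final 𝒜 s) → fm A ∈[ Γ* ] x
    fm-of-final {s} {A} x = proj₁ (proj₂ (propagated x)) s A

    lab-along : ∀ {x y a s t A} → Link a x y → 𝒜 ⊢ s —[ a ]→ t → lab s A ∈[ Γ* ] x → lab t A ∈[ Γ* ] y
    lab-along {y = y} {a} {s} {t} {A} (link {x'} ed (to , _)) tr h =
      proj₁ (proj₂ (proj₂ (propagated x'))) a y s t A ed tr (to h)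

    lab-back : ∀ {x y a s t A} → Link a x y → 𝒜 ⊢ s —[ bar Σ' a ]→ t → lab s A ∈[ Γ* ] y → lab t A ∈[ Γ* ] x
    lab-back {y = y} {a} {s} {t} {A} (link {x'} ed (_ , from)) tr h =
      from (proj₂ (proj₂ (proj₂ (propagated y))) a x' s t A ed tr h)

    dia-along : ∀ {x y a A} → Link a x y → fm (dia a A) ∈[ Γ* ] x → fm A ∈[ Γ* ] y
    dia-along {x} {y} {a} l h with accepted a
    ... | _ , tr , fin = fm-of-final y (lab-along l tr (init-of-dia x h)) fin

    dia-back : ∀ {x y a A} → Link a x y → fm (dia (bar Σ' a) A) ∈[ Γ* ] y → fm A ∈[ Γ* ] x
    dia-back {x} {y} {a} l h with accepted (bar Σ' a)
    ... | _ , tr , fin = fm-of-final x (lab-back l tr (init-of-dia y h)) fin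

    underivable : ∀ {x Γ} → Emb x Γ → ¬ DKm 𝒜 Γ
    underivable e (id-d {i = i} {p} h₁ h₂) =
      proj₁ (saturated (image e i)) (var p) (image-∈ e i h₁) (image-∈ e i h₂)
    underivable e (∧-d {i = i} {A} {B} h d₁ d₂) with proj₂ (proj₂ (saturated (image e i))) A B (image-∈ e i h)
    ... | inj₁ hA = underivable (grow-addAt e i (hA ∷ [])) d₁
    ... | inj₂ hB = underivable (grow-addAt e i (hB ∷ [])) d₂
    underivable e (∨-d {i = i} {A} {B} h d) with proj₁ (proj₂ (saturated (image e i))) A B (image-∈ e i h)
    ... | hA , hB = underivable (grow-addAt e i (hA ∷ hB ∷ [])) d
    underivable e (box-d {i = i} h d) with realise (image e i) (image-∈ e i h)
    ... | y , l , hA = underivable (grow-addChild e i l hA) d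
    underivable e (dia↑ {i = i} {j} h ed d) =
      underivable (grow-addAt e j (dia-along (image-Link e i j ed) (image-∈ e i h) ∷ [])) d
    underivable e (dia↓ {i = i} {j} ed h d) =
      underivable (grow-addAt e i (dia-back (image-Link e i j ed) (image-∈ e j h) ∷ [])) d
    underivable e (i-r {i = i} h d) =
      underivable (grow-addAt e i (init-of-dia (image e i) (image-∈ e i h) ∷ [])) d
    underivable e (t↑ {i = i} {j} h ed tr d) =
      underivable (grow-addAt e j (lab-along (image-Link e i j ed) tr (image-∈ e i h) ∷ [])) d
    underivable e (t↓ {i = i} {j} ed h tr d) =
      underivable (grow-addAt e i (lab-back (image-Link e i j ed) tr (image-∈ e j h) ∷ [])) d
    underivable e (f-r {i = i} h fin d) =
      underivable (grow-addAt e i (fm-of-final (image e i) (image-∈ e i h) fin ∷ [])) d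

represents⇒lettersAccepted : ∀ {Σ'} {S : STS Σ'} (𝒜 : FSA Σ') → Represents Σ' S 𝒜 → LettersAccepted 𝒜
represents⇒lettersAccepted 𝒜 rep a with Equivalence.to (rep a (a ∷ [])) ε
... | acc-cons tr (acc-nil fin) = _ , tr , fin

theorem6p4 : (Σ' : Alphabet) (S : STS Σ') → RegularSTS Σ' S → Closed Σ' S →
             (𝒜 : FSA Σ') → Represents Σ' S 𝒜 → (F : Fm (size Σ')) →
             (Prove₁ 𝒜 (root F) true → DKm 𝒜 (root F)) ×
             (Prove₁ 𝒜 (root F) false → ¬ DKm 𝒜 (root F))
theorem6p4 Σ' S _ _ 𝒜 rep F = prove⊤⇒DKm 𝒜 , refute
  where
  refute : Prove₁ 𝒜 (root F) false → ¬ DKm 𝒜 (root F)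
  refute pr with prove⊥⇒embedsInStable 𝒜 pr
  ... | Γ* , st , e = Countermodel.underivable 𝒜 Γ* st (represents⇒lettersAccepted 𝒜 rep) e
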